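{- For every integer $n\ge 5$, $\beta_E(J_{n,2}) = \beta_M(J_{n,2}) = \binom{n}{2} - \lfloor n/2 \rfloor$.
   Context: The Johnson graph $J_{n,2}$ has as vertices all $2$-element subsets of $\{1,\dots,n\}$, two of them $A,B$ being adjacent iff $|A\cap B|=1$; the graph distance is $d(A,B)=2-|A\cap B|$. For an edge $e=uv$ and a vertex $w$, $d(e,w)=\min\{d(u,w),d(v,w)\}$. A set $N\subseteq V(G)$ is an edge resolving set of a connected graph $G$ if for every two distinct edges $e_1,e_2$ there is $w\in N$ with $d(e_1,w)\ne d(e_2,w)$; $\beta_E(G)$ is the minimum cardinality of an edge resolving set. A set $M\subseteq V(G)$ is a mixed resolving set if for every two distinct items $a,b\in V(G)\cup E(G)$ there is $w\in M$ with $d(a,w)\ne d(b,w)$; the mixed metric dimension $\beta_M(G)$ is the minimum cardinality of a mixed resolving set. -}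

module Defs where

open import Data.Nat using (ℕ; zero; suc; _+_; _∸_; _≤_; _<_)
open import Data.Nat.Base using (_⊓_)
open import Data.Fin using (Fin; toℕ)
open import Data.Fin.Properties using (_≟_)
open import Data.Product using (Σ; ∃; _×_; _,_; proj₁; proj₂)
open import Data.Sum using (_⊎_; inj₁; inj₂)
open import Data.List using (List; length)
open import Data.List.Relation.Unary.Unique.Propositional using (Unique)
open import Data.List.Relation.Unary.Any using (Any)
open import Relation.Binary.PropositionalEquality using (_≡_)
open import Relation.Nullary using (¬_; does)
open import Data.Empty using (⊥)
open import Data.Bool using (Bool; true; false; if_then_else_; _∨_)

-- Vertices of the Johnson graph J_{n,2}: 2-element subsets {i,j} of an
-- n-element set, represented canonically as (i , j) with i < j.
V : ℕ → Set
V n = Σ (Fin n × Fin n) (λ p → toℕ (proj₁ p) < toℕ (proj₂ p))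

fst snd : ∀ {n} → V n → Fin n
fst v = proj₁ (proj₁ v)
snd v = proj₂ (proj₁ v)

_∈ᵥ_ : ∀ {n} → Fin n → V n → Bool
x ∈ᵥ v = does (x ≟ fst v) ∨ does (x ≟ snd v)

b2n : Bool → ℕ
b2n true  = 1
b2n false = 0

inter : ∀ {n} → V n → V n → ℕ
inter A B = b2n (fst A ∈ᵥ B) + b2n (snd A ∈ᵥ B)

-- graph distance in J_{n,2}: d(A,B) = 2 - |A ∩ B|
dist : ∀ {n} → V n → V n → ℕ
dist A B = 2 ∸ inter A B

Adj : ∀ {n} → V n → V n → Set
Adj A B = inter A B ≡ 1

-- Edges: an (oriented) pair of adjacent vertices; edges are compared as
-- unordered pairs via _≈E_.
E : ℕ → Set
E n = Σ (V n × V n) (λ p → Adj (proj₁ p) (proj₂ p))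

end₁ end₂ : ∀ {n} → E n → V n
end₁ e = proj₁ (proj₁ e)
end₂ e = proj₂ (proj₁ e)

_≈E_ : ∀ {n} → E n → E n → Set
e ≈E f = (end₁ e ≡ end₁ f × end₂ e ≡ end₂ f) ⊎ (end₁ e ≡ end₂ f × end₂ e ≡ end₁ f)

distE : ∀ {n} → E n → V n → ℕ
distE e w = dist (end₁ e) w ⊓ dist (end₂ e) w

EdgeResolving : ∀ {n} → List (V n) → Set
EdgeResolving {n} N = (e₁ e₂ : E n) → ¬ (e₁ ≈E e₂) →
  Any (λ w → ¬ (distE e₁ w ≡ distE e₂ w)) N

Item : ℕ → Set
Item n = V n ⊎ E n

_≈I_ : ∀ {n} → Item n → Item n → Set
inj₁ u ≈I inj₁ v = u ≡ v
inj₂ e ≈I inj₂ f = e ≈E f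
inj₁ _ ≈I inj₂ _ = ⊥
inj₂ _ ≈I inj₁ _ = ⊥

distI : ∀ {n} → Item n → V n → ℕ
distI (inj₁ v) w = dist v w
distI (inj₂ e) w = distE e w

MixedResolving : ∀ {n} → List (V n) → Set
MixedResolving {n} M = (a b : Item n) → ¬ (a ≈I b) →
  Any (λ w → ¬ (distI a w ≡ distI b w)) M

IsMinCard : ∀ {n} → (List (V n) → Set) → ℕ → Set
IsMinCard {n} P k =
  (Σ (List (V n)) (λ S → Unique S × P S × length S ≡ k)) ×
  ((S : List (V n)) → Unique S → P S → k ≤ length S)

edgeMetricDim≡ : ℕ → ℕ → Set
edgeMetricDim≡ n k = IsMinCard {n} EdgeResolving k

mixedMetricDim≡ : ℕ → ℕ → Set
mixedMetricDim≡ n k = IsMinCard {n} MixedResolving k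

{-# OPTIONS --safe #-}
module Submission where

-- For a vertex w and an item a (a vertex or an edge) of J(n,2), d(a, w) is 0 when w is an
-- end of a, 2 when w misses every point of the ends of a, and 1 otherwise.
--
-- Lower bound: if P = {x, y} and Q = {x, z} are adjacent and R = {y, z}, the edges PR and QR
-- have the same points {x, y, z} and the same ends apart from P and Q, so only P or Q can
-- resolve them. Hence an edge resolving set is a vertex cover, and the vertices outside it
-- are pairwise disjoint 2-sets, at most ⌊n/2⌋ of them.
--
-- Upper bound: the complement of any matching M is mixed resolving once n ≥ 5. Two distinct
-- items are resolved by an unmatched end of one of them that is not an end of the other.
-- When there is none, one of them has an end X ∈ M that is not an end of the other, and a
-- vertex {q, t} with q ∈ X and t avoiding at most four given points is unmatched, meets X
-- and misses the other item. The matching {{2k, 2k+1}} has ⌊n/2⌋ members.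

open import Defs
open import Data.Empty using (⊥; ⊥-elim)
open import Data.Fin using (Fin; zero; suc; toℕ; fromℕ<)
open import Data.Fin.Properties using (_≟_; <-cmp; toℕ-injective; toℕ-fromℕ<; toℕ<n; ¬∀⟶∃¬)
  renaming (suc-injective to Fin-suc-injective)
open import Data.List using (List; []; _∷_; length; filter; map; allFin; _++_)
open import Data.List.Membership.Propositional using (_∈_; _∉_; lose)
open import Data.List.Membership.Propositional.Properties
  using (∈-filter⁺; ∈-filter⁻; ∈-map⁺; ∈-map⁻; ∈-++⁺ˡ; ∈-++⁺ʳ; ∈-allFin)
open import Data.List.Properties using (filter-notAll; length-++; length-map; length-tabulate)
open import Data.List.Relation.Binary.Subset.Propositional using (_⊆_)
import Data.List.Relation.Unary.All as All
open import Data.List.Relation.Unary.AllPairs using ([]; _∷_)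
import Data.List.Relation.Unary.Any as Any
open import Data.List.Relation.Unary.Any using (Any; here; there)
open import Data.List.Relation.Unary.Any.Properties using (Any-⊎⁻)
open import Data.List.Relation.Unary.Unique.Propositional using (Unique)
import Data.List.Relation.Unary.Unique.Propositional.Properties as Unique
open import Data.Nat using (ℕ; zero; suc; _+_; _*_; _∸_; _≤_; _<_; _/_; _⊓_; z≤n; s≤s)
open import Data.Nat.Combinatorics using (_C_; nC1≡n; nCk+nC[k+1]≡[n+1]C[k+1])
open import Data.Nat.DivMod using (/-monoˡ-≤; m*n/n≡m; m/n*n≤m)
open import Data.Nat.Divisibility using (_∣_; _∣?_; n∣m*n; ∣m+n∣m⇒∣n; ∣1⇒≡1)
open import Data.Nat.Properties
  using ( <-irrelevant; <-irrefl; <-asym; ≤∧≢⇒<; <⇒≢; <⇒≱; <-≤-trans; <-trans; n<1+n; ≤-trans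
        ; ≤-antisym; +-suc; +-comm; suc-injective; *-cancelʳ-≡; *-monoˡ-≤; m∸n≤m; ∸-monoʳ-≤
        ; m+n∸n≡m; m+n∸m≡n; ⊓-sel; ⊓-zeroʳ; m<n⇒m⊓o<n; m<n⇒o⊓m<n; module ≤-Reasoning)
  renaming (_≟_ to _≟ℕ_)
open import Data.Product using (∃; _×_; _,_; proj₁; proj₂; uncurry)
open import Data.Sum using (_⊎_; inj₁; inj₂; [_,_]′)
open import Function using (_∘_)
open import Relation.Binary using (DecidableEquality; tri<; tri≈; tri>)
open import Relation.Binary.PropositionalEquality
open import Relation.Nullary using (¬_; ¬?; Dec; yes; no; does; contradiction)
open import Relation.Nullary.Decidable using (_⊎-dec_; _×-dec_; map′; decidable-stable)
open import Relation.Unary using (Decidable)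
open import Relation.Unary.Properties using (∁?)

-- dist A B unfolds to 2 ∸ (count (fst A ∈ₚ? B) + count (snd A ∈ₚ? B)), so the facts about
-- distances are instances of these.
private
  count : ∀ {P : Set} → Dec P → ℕ
  count = b2n ∘ does

  module _ {P Q : Set} where

    both-hold : (p : Dec P) (q : Dec Q) → P → Q → 2 ∸ (count p + count q) ≡ 0
    both-hold (yes _) (yes _) _ _ = refl
    both-hold (no ¬p) _ p _ = contradiction p ¬p
    both-hold (yes _) (no ¬q) _ q = contradiction q ¬q

    both-hold⁻ : (p : Dec P) (q : Dec Q) → 2 ∸ (count p + count q) ≡ 0 → P × Q
    both-hold⁻ (yes p) (yes q) _ = p , q
    both-hold⁻ (yes _) (no _) ()
    both-hold⁻ (no _) (yes _) ()
    both-hold⁻ (no _) (no _) ()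

    both-fail : (p : Dec P) (q : Dec Q) → ¬ P → ¬ Q → 2 ∸ (count p + count q) ≡ 2
    both-fail (no _) (no _) _ _ = refl
    both-fail (yes p) _ ¬p _ = contradiction p ¬p
    both-fail (no _) (yes q) _ ¬q = contradiction q ¬q

    both-fail⁻ : (p : Dec P) (q : Dec Q) → 2 ∸ (count p + count q) ≡ 2 → ¬ P × ¬ Q
    both-fail⁻ (no ¬p) (no ¬q) _ = ¬p , ¬q
    both-fail⁻ (yes _) (yes _) ()
    both-fail⁻ (yes _) (no _) ()
    both-fail⁻ (no _) (yes _) ()

    exactly-one : (p : Dec P) (q : Dec Q) → P ⊎ Q → ¬ (P × Q) → count p + count q ≡ 1
    exactly-one (yes p) (yes q) _ ¬pq = contradiction (p , q) ¬pq
    exactly-one (yes _) (no _) _ _ = refl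
    exactly-one (no _) (yes _) _ _ = refl
    exactly-one (no ¬p) (no ¬q) p⊎q _ = ⊥-elim ([ ¬p , ¬q ]′ p⊎q)

    exactly-one⁻ : (p : Dec P) (q : Dec Q) → count p + count q ≡ 1 → P ⊎ Q
    exactly-one⁻ (yes p) _ _ = inj₁ p
    exactly-one⁻ (no _) (yes q) _ = inj₂ q
    exactly-one⁻ (no _) (no _) ()

  <2∧≢0⇒≡1 : ∀ {m} → m < 2 → m ≢ 0 → m ≡ 1
  <2∧≢0⇒≡1 {zero} _ m≢0 = contradiction refl m≢0
  <2∧≢0⇒≡1 {suc zero} _ _ = refl
  <2∧≢0⇒≡1 {suc (suc _)} (s≤s (s≤s ())) _

  zero-vs-nonzero : ∀ {m k} → m ≡ 0 → k ≢ 0 → m ≢ k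
  zero-vs-nonzero refl k≢0 0≡k = k≢0 (sym 0≡k)

  below-two-vs-two : ∀ {m k} → m < 2 → k ≡ 2 → m ≢ k
  below-two-vs-two m<2 refl = <⇒≢ m<2

-- Points, distances and edges of J(n,2)

module _ {n : ℕ} where

  infix 4 _∈ₚ_ _∈ₚ?_ _≟ᵥ_

  data _∈ₚ_ (x : Fin n) (v : V n) : Set where
    at-fst : x ≡ fst v → x ∈ₚ v
    at-snd : x ≡ snd v → x ∈ₚ v

  _∈ₚ?_ : (x : Fin n) (v : V n) → Dec (x ∈ₚ v)
  x ∈ₚ? v = map′ [ at-fst , at-snd ]′ (λ { (at-fst p) → inj₁ p ; (at-snd p) → inj₂ p })
                 ((x ≟ fst v) ⊎-dec (x ≟ snd v))

  Disjoint Shared : V n → V n → Set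
  Disjoint A B = ∀ {x} → x ∈ₚ A → x ∈ₚ B → ⊥
  Shared A B = ∃ λ x → x ∈ₚ A × x ∈ₚ B

  V-≡ : {A B : V n} → fst A ≡ fst B → snd A ≡ snd B → A ≡ B
  V-≡ {_ , p} {_ , q} refl refl = cong (_ ,_) (<-irrelevant p q)

  _≟ᵥ_ : DecidableEquality (V n)
  A ≟ᵥ B = map′ (uncurry V-≡) (λ { refl → refl , refl }) ((fst A ≟ fst B) ×-dec (snd A ≟ snd B))

  fst≢snd : (v : V n) → fst v ≢ snd v
  fst≢snd (_ , fst<snd) eq = <-irrefl (cong toℕ eq) fst<snd

  ⊆⇒≡ : {A B : V n} → fst A ∈ₚ B → snd A ∈ₚ B → A ≡ B
  ⊆⇒≡ {A} (at-fst p) (at-fst q) = contradiction (trans p (sym q)) (fst≢snd A)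
  ⊆⇒≡ (at-fst p) (at-snd q) = V-≡ p q
  ⊆⇒≡ {A} {B} (at-snd p) (at-fst q) =
    contradiction (subst₂ _<_ (cong toℕ p) (cong toℕ q) (proj₂ A)) (<-asym (proj₂ B))
  ⊆⇒≡ {A} (at-snd p) (at-snd q) = contradiction (trans p (sym q)) (fst≢snd A)

  other-point : {x : Fin n} {v : V n} → x ∈ₚ v →
    ∃ λ y → y ∈ₚ v × y ≢ x × (∀ {z} → z ∈ₚ v → z ≡ x ⊎ z ≡ y)
  other-point {v = v} (at-fst refl) = snd v , at-snd refl , (λ eq → fst≢snd v (sym eq)) , λ
    { (at-fst z≡x) → inj₁ z≡x ; (at-snd z≡y) → inj₂ z≡y }
  other-point {v = v} (at-snd refl) = fst v , at-fst refl , fst≢snd v , λ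
    { (at-fst z≡y) → inj₂ z≡y ; (at-snd z≡x) → inj₁ z≡x }

  two-points : {x y z : Fin n} {v : V n} → x ∈ₚ v → y ∈ₚ v → x ≢ y → z ∈ₚ v → z ≡ x ⊎ z ≡ y
  two-points x∈v y∈v x≢y z∈v with other-point x∈v
  ... | _ , _ , _ , v⊆xy′ with v⊆xy′ y∈v | v⊆xy′ z∈v
  ...   | inj₁ refl | _ = contradiction refl x≢y
  ...   | inj₂ _ | inj₁ z≡x = inj₁ z≡x
  ...   | inj₂ refl | inj₂ z≡y = inj₂ z≡y

  ≡-from-two-points : {x y : Fin n} {A B : V n} →
    x ∈ₚ A → y ∈ₚ A → x ∈ₚ B → y ∈ₚ B → x ≢ y → A ≡ B
  ≡-from-two-points {A = A} {B} x∈A y∈A x∈B y∈B x≢y = ⊆⇒≡ (A⊆B (at-fst refl)) (A⊆B (at-snd refl))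
    where
    A⊆B : ∀ {z} → z ∈ₚ A → z ∈ₚ B
    A⊆B z∈A with two-points x∈A y∈A x≢y z∈A
    ... | inj₁ refl = x∈B
    ... | inj₂ refl = y∈B

  pair : (x y : Fin n) → x ≢ y → V n
  pair x y x≢y with <-cmp x y
  ... | tri< x<y _ _ = (x , y) , x<y
  ... | tri≈ _ x≡y _ = contradiction x≡y x≢y
  ... | tri> _ _ y<x = (y , x) , y<x

  pair-∈ : (x y : Fin n) (x≢y : x ≢ y) → x ∈ₚ pair x y x≢y × y ∈ₚ pair x y x≢y
  pair-∈ x y x≢y with <-cmp x y
  ... | tri< _ _ _ = at-fst refl , at-snd refl
  ... | tri≈ _ x≡y _ = contradiction x≡y x≢y
  ... | tri> _ _ _ = at-snd refl , at-fst refl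

  ∈-pair⁻ : {x y z : Fin n} (x≢y : x ≢ y) → z ∈ₚ pair x y x≢y → z ≡ x ⊎ z ≡ y
  ∈-pair⁻ {x} {y} x≢y = two-points (proj₁ (pair-∈ x y x≢y)) (proj₂ (pair-∈ x y x≢y)) x≢y

  dist-refl : (A : V n) → dist A A ≡ 0
  dist-refl A = both-hold (fst A ∈ₚ? A) (snd A ∈ₚ? A) (at-fst refl) (at-snd refl)

  dist≡0⇒≡ : {A B : V n} → dist A B ≡ 0 → A ≡ B
  dist≡0⇒≡ {A} {B} d≡0 = uncurry ⊆⇒≡ (both-hold⁻ (fst A ∈ₚ? B) (snd A ∈ₚ? B) d≡0)

  Disjoint⇒dist≡2 : {A B : V n} → Disjoint A B → dist A B ≡ 2
  Disjoint⇒dist≡2 {A} {B} A∩B=∅ =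
    both-fail (fst A ∈ₚ? B) (snd A ∈ₚ? B) (A∩B=∅ (at-fst refl)) (A∩B=∅ (at-snd refl))

  dist≡2⇒Disjoint : {A B : V n} → dist A B ≡ 2 → Disjoint A B
  dist≡2⇒Disjoint {A} {B} d≡2 (at-fst refl) = proj₁ (both-fail⁻ (fst A ∈ₚ? B) (snd A ∈ₚ? B) d≡2)
  dist≡2⇒Disjoint {A} {B} d≡2 (at-snd refl) = proj₂ (both-fail⁻ (fst A ∈ₚ? B) (snd A ∈ₚ? B) d≡2)

  dist<2 : {x : Fin n} {A B : V n} → x ∈ₚ A → x ∈ₚ B → dist A B < 2
  dist<2 {A = A} {B} x∈A x∈B = ≤∧≢⇒< (m∸n≤m 2 (inter A B)) (λ d≡2 → dist≡2⇒Disjoint d≡2 x∈A x∈B)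

  shared⇒Adj : {x : Fin n} {A B : V n} → A ≢ B → x ∈ₚ A → x ∈ₚ B → Adj A B
  shared⇒Adj {A = A} {B} A≢B x∈A x∈B =
    exactly-one (fst A ∈ₚ? B) (snd A ∈ₚ? B) (endpoint-in-B x∈A) (A≢B ∘ uncurry ⊆⇒≡)
    where
    endpoint-in-B : _ ∈ₚ A → fst A ∈ₚ B ⊎ snd A ∈ₚ B
    endpoint-in-B (at-fst refl) = inj₁ x∈B
    endpoint-in-B (at-snd refl) = inj₂ x∈B

  Adj⇒≢ : {A B : V n} → Adj A B → A ≢ B
  Adj⇒≢ {A} adj refl = contradiction (trans (sym (cong (2 ∸_) adj)) (dist-refl A)) λ ()

  Adj⇒Shared : {A B : V n} → Adj A B → Shared A B
  Adj⇒Shared {A} {B} adj with exactly-one⁻ (fst A ∈ₚ? B) (snd A ∈ₚ? B) adj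
  ... | inj₁ fst∈B = fst A , at-fst refl , fst∈B
  ... | inj₂ snd∈B = snd A , at-snd refl , snd∈B

  infix 4 _∈ₑ_ _∈ₑ?_ _∈ₛ_ _∈ₛ?_

  data _∈ₑ_ (X : V n) (e : E n) : Set where
    at-end₁ : X ≡ end₁ e → X ∈ₑ e
    at-end₂ : X ≡ end₂ e → X ∈ₑ e

  _∈ₑ?_ : (X : V n) (e : E n) → Dec (X ∈ₑ e)
  X ∈ₑ? e = map′ [ at-end₁ , at-end₂ ]′ (λ { (at-end₁ p) → inj₁ p ; (at-end₂ p) → inj₂ p })
                 ((X ≟ᵥ end₁ e) ⊎-dec (X ≟ᵥ end₂ e))

  _∈ₛ_ : Fin n → E n → Set
  x ∈ₛ e = ∃ λ X → X ∈ₑ e × x ∈ₚ X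

  _∈ₛ?_ : (x : Fin n) (e : E n) → Dec (x ∈ₛ e)
  x ∈ₛ? e = map′ [ (λ p → end₁ e , at-end₁ refl , p) , (λ p → end₂ e , at-end₂ refl , p) ]′
                 (λ { (_ , at-end₁ refl , p) → inj₁ p ; (_ , at-end₂ refl , p) → inj₂ p })
                 ((x ∈ₚ? end₁ e) ⊎-dec (x ∈ₚ? end₂ e))

  end₁≢end₂ : (e : E n) → end₁ e ≢ end₂ e
  end₁≢end₂ (_ , adj) = Adj⇒≢ adj

  distinct-ends : {X Y : V n} {e : E n} → X ∈ₑ e → Y ∈ₑ e → X ≢ Y →
    (X ≡ end₁ e × Y ≡ end₂ e) ⊎ (X ≡ end₂ e × Y ≡ end₁ e)
  distinct-ends (at-end₁ p) (at-end₁ q) X≢Y = contradiction (trans p (sym q)) X≢Y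
  distinct-ends (at-end₁ p) (at-end₂ q) _ = inj₁ (p , q)
  distinct-ends (at-end₂ p) (at-end₁ q) _ = inj₂ (p , q)
  distinct-ends (at-end₂ p) (at-end₂ q) X≢Y = contradiction (trans p (sym q)) X≢Y

  ≈E-from-ends : {X Y : V n} {e f : E n} → X ∈ₑ e → Y ∈ₑ e → X ≢ Y → X ∈ₑ f → Y ∈ₑ f → e ≈E f
  ≈E-from-ends X∈e Y∈e X≢Y X∈f Y∈f with distinct-ends X∈e Y∈e X≢Y | distinct-ends X∈f Y∈f X≢Y
  ... | inj₁ (refl , refl) | inj₁ (p , q) = inj₁ (p , q)
  ... | inj₁ (refl , refl) | inj₂ (p , q) = inj₂ (p , q)
  ... | inj₂ (refl , refl) | inj₁ (p , q) = inj₂ (q , p)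
  ... | inj₂ (refl , refl) | inj₂ (p , q) = inj₁ (q , p)

  ≈E-sym : {e f : E n} → e ≈E f → f ≈E e
  ≈E-sym (inj₁ (p , q)) = inj₁ (sym p , sym q)
  ≈E-sym (inj₂ (p , q)) = inj₂ (sym q , sym p)

  any-end? : {P : V n → Set} → Decidable P → (e : E n) →
    (∃ λ X → X ∈ₑ e × P X) ⊎ (∀ {X} → X ∈ₑ e → ¬ P X)
  any-end? P? e with P? (end₁ e) | P? (end₂ e)
  ... | yes p | _ = inj₁ (end₁ e , at-end₁ refl , p)
  ... | no _ | yes p = inj₁ (end₂ e , at-end₂ refl , p)
  ... | no ¬p₁ | no ¬p₂ = inj₂ λ { (at-end₁ refl) → ¬p₁ ; (at-end₂ refl) → ¬p₂ }

  distinct-ends-exhaust : {X Y Z : V n} {e : E n} → X ∈ₑ e → Y ∈ₑ e → X ≢ Y → Z ∈ₑ e → Z ≡ X ⊎ Z ≡ Y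
  distinct-ends-exhaust X∈e Y∈e X≢Y Z∈e with distinct-ends X∈e Y∈e X≢Y | Z∈e
  ... | inj₁ (refl , refl) | at-end₁ p = inj₁ p
  ... | inj₁ (refl , refl) | at-end₂ p = inj₂ p
  ... | inj₂ (refl , refl) | at-end₁ p = inj₂ p
  ... | inj₂ (refl , refl) | at-end₂ p = inj₁ p

  distinct-ends-shared : {X Y : V n} {e : E n} → X ∈ₑ e → Y ∈ₑ e → X ≢ Y → Shared X Y
  distinct-ends-shared {e = e} X∈e Y∈e X≢Y with distinct-ends X∈e Y∈e X≢Y | Adj⇒Shared (proj₂ e)
  ... | inj₁ (refl , refl) | shared = shared
  ... | inj₂ (refl , refl) | x , x∈end₁ , x∈end₂ = x , x∈end₂ , x∈end₁

  other-end : {X : V n} {e : E n} → X ∈ₑ e → ∃ λ Y → Y ∈ₑ e × X ≢ Y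
  other-end {e = e} (at-end₁ refl) = end₂ e , at-end₂ refl , end₁≢end₂ e
  other-end {e = e} (at-end₂ refl) = end₁ e , at-end₁ refl , λ eq → end₁≢end₂ e (sym eq)

  distE-end : {X : V n} {e : E n} → X ∈ₑ e → distE e X ≡ 0
  distE-end {e = e} (at-end₁ refl) = cong (_⊓ dist (end₂ e) (end₁ e)) (dist-refl (end₁ e))
  distE-end {e = e} (at-end₂ refl) = trans (cong (dist (end₁ e) (end₂ e) ⊓_) (dist-refl (end₂ e))) (⊓-zeroʳ _)

  distE≡0⇒∈ₑ : {e : E n} {w : V n} → distE e w ≡ 0 → w ∈ₑ e
  distE≡0⇒∈ₑ {e} {w} d≡0 with ⊓-sel (dist (end₁ e) w) (dist (end₂ e) w)
  ... | inj₁ d≡d₁ = at-end₁ (sym (dist≡0⇒≡ (trans (sym d≡d₁) d≡0)))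
  ... | inj₂ d≡d₂ = at-end₂ (sym (dist≡0⇒≡ (trans (sym d≡d₂) d≡0)))

  distE<2 : {x : Fin n} {e : E n} {w : V n} → x ∈ₛ e → x ∈ₚ w → distE e w < 2
  distE<2 (_ , at-end₁ refl , x∈X) x∈w = m<n⇒m⊓o<n _ (dist<2 x∈X x∈w)
  distE<2 (_ , at-end₂ refl , x∈X) x∈w = m<n⇒o⊓m<n _ (dist<2 x∈X x∈w)

  distE≡1 : {x : Fin n} {e : E n} {w : V n} → ¬ w ∈ₑ e → x ∈ₛ e → x ∈ₚ w → distE e w ≡ 1
  distE≡1 w∉e x∈e x∈w = <2∧≢0⇒≡1 (distE<2 x∈e x∈w) (w∉e ∘ distE≡0⇒∈ₑ)

  distE≡2 : {e : E n} {w : V n} → (∀ {x} → x ∈ₛ e → ¬ x ∈ₚ w) → distE e w ≡ 2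
  distE≡2 misses = cong₂ _⊓_ (Disjoint⇒dist≡2 (λ x∈end₁ → misses (_ , at-end₁ refl , x∈end₁)))
                             (Disjoint⇒dist≡2 (λ x∈end₂ → misses (_ , at-end₂ refl , x∈end₂)))

  distE-cong : {e f : E n} {w : V n} → (w ∈ₑ e → w ∈ₑ f) → (w ∈ₑ f → w ∈ₑ e) →
    (∀ {x} → x ∈ₛ e → x ∈ₛ f) → (∀ {x} → x ∈ₛ f → x ∈ₛ e) → distE e w ≡ distE f w
  distE-cong {e} {f} {w} e⇒f f⇒e se⇒sf sf⇒se with w ∈ₑ? e
  ... | yes w∈e = trans (distE-end w∈e) (sym (distE-end (e⇒f w∈e)))
  ... | no w∉e = by-points (fst w ∈ₛ? e) (snd w ∈ₛ? e)
    where
    through : ∀ {x} → x ∈ₛ e → x ∈ₚ w → distE e w ≡ distE f w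
    through x∈e x∈w = trans (distE≡1 w∉e x∈e x∈w) (sym (distE≡1 (w∉e ∘ f⇒e) (se⇒sf x∈e) x∈w))

    misses : ¬ fst w ∈ₛ e → ¬ snd w ∈ₛ e → ∀ {x} → x ∈ₛ e → ¬ x ∈ₚ w
    misses fst∉e _ x∈e (at-fst refl) = fst∉e x∈e
    misses _ snd∉e x∈e (at-snd refl) = snd∉e x∈e

    by-points : Dec (fst w ∈ₛ e) → Dec (snd w ∈ₛ e) → distE e w ≡ distE f w
    by-points (yes fst∈e) _ = through fst∈e (at-fst refl)
    by-points (no _) (yes snd∈e) = through snd∈e (at-snd refl)
    by-points (no fst∉e) (no snd∉e) =
      trans (distE≡2 (misses fst∉e snd∉e)) (sym (distE≡2 (misses fst∉e snd∉e ∘ sf⇒se)))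

  distE-twins : {e f : E n} {w : V n} → end₂ e ≡ end₂ f → end₁ e ≢ w → end₁ f ≢ w →
    (∀ {x} → x ∈ₛ e → x ∈ₛ f) → (∀ {x} → x ∈ₛ f → x ∈ₛ e) → distE e w ≡ distE f w
  distE-twins {e} {f} same-end₂ e₁≢w f₁≢w =
    distE-cong (move e₁≢w same-end₂) (move f₁≢w (sym same-end₂))
    where
    move : ∀ {g h w} → end₁ g ≢ w → end₂ g ≡ end₂ h → w ∈ₑ g → w ∈ₑ h
    move g₁≢w _ (at-end₁ w≡g₁) = contradiction (sym w≡g₁) g₁≢w
    move _ same (at-end₂ w≡g₂) = at-end₂ (trans w≡g₂ same)

-- Counting

module _ {A : Set} where

  Unique-⊆⇒length≤ : DecidableEquality A → {xs ys : List A} → Unique xs → xs ⊆ ys → length xs ≤ length ys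
  Unique-⊆⇒length≤ _≟ₐ_ {[]} _ _ = z≤n
  Unique-⊆⇒length≤ _≟ₐ_ {x ∷ xs} {ys} (x∉xs ∷ xs!) x∷xs⊆ys =
    <-≤-trans (s≤s (Unique-⊆⇒length≤ _≟ₐ_ xs! xs⊆ys-x)) (filter-notAll other? ys x∈ys)
    where
    other? : Decidable (x ≢_)
    other? y = ¬? (x ≟ₐ y)

    xs⊆ys-x : xs ⊆ filter other? ys
    xs⊆ys-x z∈xs = ∈-filter⁺ other? (x∷xs⊆ys (there z∈xs)) (All.lookup x∉xs z∈xs)

    x∈ys : Any (λ y → ¬ x ≢ y) ys
    x∈ys = Any.map (λ x≡y x≢y → x≢y x≡y) (x∷xs⊆ys (here refl))

  length-filter+filter-∁ : {P : A → Set} (P? : Decidable P) (xs : List A) →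
    length (filter P? xs) + length (filter (∁? P?) xs) ≡ length xs
  length-filter+filter-∁ P? [] = refl
  length-filter+filter-∁ P? (x ∷ xs) with P? x
  ... | yes _ = cong suc (length-filter+filter-∁ P? xs)
  ... | no _ = trans (+-suc _ _) (cong suc (length-filter+filter-∁ P? xs))

∃-∉ : ∀ {n} (xs : List (Fin n)) → length xs < n → ∃ λ t → t ∉ xs
∃-∉ {n} xs xs<n = ¬∀⟶∃¬ n (_∈ xs) (λ t → Any.any? (t ≟_) xs) λ all∈xs →
  <⇒≱ xs<n (subst (_≤ length xs) (length-tabulate (λ i → i))
                  (Unique-⊆⇒length≤ _≟_ (Unique.allFin⁺ n) (λ {t} _ → all∈xs t)))

module _ {n : ℕ} where

  zero-with : Fin n → V (suc n)
  zero-with j = (zero , suc j) , s≤s z≤n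

  sucᵥ : V n → V (suc n)
  sucᵥ ((i , j) , i<j) = (suc i , suc j) , s≤s i<j

vertices : (n : ℕ) → List (V n)
vertices zero = []
vertices (suc n) = map zero-with (allFin n) ++ map sucᵥ (vertices n)

∈-vertices : ∀ {n} (v : V n) → v ∈ vertices n
∈-vertices {suc n} ((zero , suc j) , s≤s z≤n) = ∈-++⁺ˡ (∈-map⁺ zero-with (∈-allFin j))
∈-vertices {suc n} ((suc i , suc j) , s≤s i<j) =
  ∈-++⁺ʳ (map zero-with (allFin n)) (∈-map⁺ sucᵥ (∈-vertices ((i , j) , i<j)))

vertices-unique : ∀ n → Unique (vertices n)
vertices-unique zero = []
vertices-unique (suc n) =
  Unique.++⁺ (Unique.map⁺ zero-with-injective (Unique.allFin⁺ n))
             (Unique.map⁺ sucᵥ-injective (vertices-unique n))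
             (λ (v∈l , v∈r) → apart (∈-map⁻ zero-with v∈l) (∈-map⁻ sucᵥ v∈r))
  where
  zero-with-injective : ∀ {i j} → zero-with {n} i ≡ zero-with j → i ≡ j
  zero-with-injective eq = Fin-suc-injective (cong snd eq)

  sucᵥ-injective : ∀ {A B : V n} → sucᵥ A ≡ sucᵥ B → A ≡ B
  sucᵥ-injective eq = V-≡ (Fin-suc-injective (cong fst eq)) (Fin-suc-injective (cong snd eq))

  apart : ∀ {v} → (∃ λ j → j ∈ allFin n × v ≡ zero-with j) → (∃ λ A → A ∈ vertices n × v ≡ sucᵥ A) → ⊥
  apart (_ , _ , refl) (_ , _ , ())

length-vertices : ∀ n → length (vertices n) ≡ n C 2
length-vertices zero = refl
length-vertices (suc n) = begin
  length (map zero-with (allFin n) ++ map sucᵥ (vertices n))     ≡⟨ length-++ (map zero-with (allFin n)) ⟩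
  length (map zero-with (allFin n)) + length (map sucᵥ (vertices n))
    ≡⟨ cong₂ _+_ (trans (length-map zero-with (allFin n)) (length-tabulate (λ i → i)))
                 (trans (length-map sucᵥ (vertices n)) (length-vertices n)) ⟩
  n + n C 2                                                       ≡⟨ cong (_+ n C 2) (sym (nC1≡n n)) ⟩
  n C 1 + n C 2                                                   ≡⟨ nCk+nC[k+1]≡[n+1]C[k+1] n 1 ⟩
  suc n C 2                                                       ∎
  where open ≡-Reasoning

module _ {n : ℕ} where

  points : List (V n) → List (Fin n)
  points [] = []
  points (v ∷ vs) = fst v ∷ snd v ∷ points vs

  length-points : (vs : List (V n)) → length (points vs) ≡ length vs * 2
  length-points [] = refl
  length-points (_ ∷ vs) = cong (2 +_) (length-points vs)

  ∈-points⁻ : {x : Fin n} (vs : List (V n)) → x ∈ points vs → ∃ λ v → v ∈ vs × x ∈ₚ v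
  ∈-points⁻ (v ∷ _) (here x≡fst) = v , here refl , at-fst x≡fst
  ∈-points⁻ (v ∷ _) (there (here x≡snd)) = v , here refl , at-snd x≡snd
  ∈-points⁻ (_ ∷ vs) (there (there x∈vs)) with ∈-points⁻ vs x∈vs
  ... | v , v∈vs , x∈v = v , there v∈vs , x∈v

  PairwiseDisjoint : List (V n) → Set
  PairwiseDisjoint vs = ∀ {A B} → A ∈ vs → B ∈ vs → A ≢ B → Disjoint A B

  points-unique : {vs : List (V n)} → Unique vs → PairwiseDisjoint vs → Unique (points vs)
  points-unique [] _ = []
  points-unique {v ∷ vs} (v∉vs ∷ vs!) disjoint =
    (fst≢snd v All.∷ All.tabulate (apart (at-fst refl))) ∷
    All.tabulate (apart (at-snd refl)) ∷
    points-unique vs! (λ A∈vs B∈vs → disjoint (there A∈vs) (there B∈vs))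
    where
    apart : ∀ {x y} → x ∈ₚ v → y ∈ points vs → x ≢ y
    apart x∈v y∈pts refl with ∈-points⁻ vs y∈pts
    ... | A , A∈vs , x∈A = disjoint (here refl) (there A∈vs) (All.lookup v∉vs A∈vs) x∈v x∈A

  PairwiseDisjoint⇒length≤ : {vs : List (V n)} → Unique vs → PairwiseDisjoint vs → length vs ≤ n / 2
  PairwiseDisjoint⇒length≤ {vs} vs! disjoint =
    subst (_≤ n / 2) (m*n/n≡m (length vs) 2) (/-monoˡ-≤ 2 length*2≤n)
    where
    length*2≤n : length vs * 2 ≤ n
    length*2≤n = subst₂ _≤_ (length-points vs) (length-tabulate (λ i → i))
      (Unique-⊆⇒length≤ _≟_ (points-unique vs! disjoint) (λ {x} _ → ∈-allFin x))

-- Edge resolving sets are vertex covers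

module _ {n : ℕ} {S : List (V n)} (S-resolving : EdgeResolving S) where

  edge-resolving⇒vertex-cover : (e : E n) → end₁ e ∈ S ⊎ end₂ e ∈ S
  edge-resolving⇒vertex-cover ((P , Q) , P~Q) with Adj⇒Shared P~Q
  ... | x , x∈P , x∈Q with other-point x∈P | other-point x∈Q
  ... | y , y∈P , y≢x , P⊆xy | z , z∈Q , z≢x , Q⊆xz =
    Any-⊎⁻ (Any.map resolver-is-P-or-Q (S-resolving PR QR PR≉QR))
    where
    y≢z : y ≢ z
    y≢z refl = Adj⇒≢ P~Q (≡-from-two-points x∈P y∈P x∈Q z∈Q (λ eq → y≢x (sym eq)))

    R : V n
    R = pair y z y≢z

    y∈R : y ∈ₚ R
    y∈R = proj₁ (pair-∈ y z y≢z)

    z∈R : z ∈ₚ R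
    z∈R = proj₂ (pair-∈ y z y≢z)

    x∉R : ¬ x ∈ₚ R
    x∉R x∈R = [ (λ eq → y≢x (sym eq)) , (λ eq → z≢x (sym eq)) ]′ (∈-pair⁻ y≢z x∈R)

    P≢R : P ≢ R
    P≢R P≡R = x∉R (subst (x ∈ₚ_) P≡R x∈P)

    PR QR : E n
    PR = (P , R) , shared⇒Adj P≢R y∈P y∈R
    QR = (Q , R) , shared⇒Adj (λ Q≡R → x∉R (subst (x ∈ₚ_) Q≡R x∈Q)) z∈Q z∈R

    PR≉QR : ¬ PR ≈E QR
    PR≉QR (inj₁ (P≡Q , _)) = Adj⇒≢ P~Q P≡Q
    PR≉QR (inj₂ (P≡R , _)) = P≢R P≡R

    supp-PR⊆QR : ∀ {t} → t ∈ₛ PR → t ∈ₛ QR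
    supp-PR⊆QR (_ , at-end₁ refl , t∈P) with P⊆xy t∈P
    ... | inj₁ refl = Q , at-end₁ refl , x∈Q
    ... | inj₂ refl = R , at-end₂ refl , y∈R
    supp-PR⊆QR (_ , at-end₂ refl , t∈R) = R , at-end₂ refl , t∈R

    supp-QR⊆PR : ∀ {t} → t ∈ₛ QR → t ∈ₛ PR
    supp-QR⊆PR (_ , at-end₁ refl , t∈Q) with Q⊆xz t∈Q
    ... | inj₁ refl = P , at-end₁ refl , x∈P
    ... | inj₂ refl = R , at-end₂ refl , z∈R
    supp-QR⊆PR (_ , at-end₂ refl , t∈R) = R , at-end₂ refl , t∈R

    resolver-is-P-or-Q : ∀ {w} → distE PR w ≢ distE QR w → P ≡ w ⊎ Q ≡ w
    resolver-is-P-or-Q {w} resolves with P ≟ᵥ w | Q ≟ᵥ w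
    ... | yes P≡w | _ = inj₁ P≡w
    ... | no _ | yes Q≡w = inj₂ Q≡w
    ... | no P≢w | no Q≢w = contradiction (distE-twins refl P≢w Q≢w supp-PR⊆QR supp-QR⊆PR) resolves

  outside-disjoint : {A B : V n} → A ∉ S → B ∉ S → A ≢ B → Disjoint A B
  outside-disjoint A∉S B∉S A≢B x∈A x∈B =
    [ A∉S , B∉S ]′ (edge-resolving⇒vertex-cover ((_ , _) , shared⇒Adj A≢B x∈A x∈B))

module _ {n : ℕ} where

  _∈?_ : (v : V n) (vs : List (V n)) → Dec (v ∈ vs)
  v ∈? vs = Any.any? (v ≟ᵥ_) vs

  edge-resolving⇒length≥ : (S : List (V n)) → Unique S → EdgeResolving S → n C 2 ∸ n / 2 ≤ length S
  edge-resolving⇒length≥ S S! S-resolving = begin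
    n C 2 ∸ n / 2                                   ≤⟨ ∸-monoʳ-≤ (n C 2) outside≤n/2 ⟩
    n C 2 ∸ length outside                          ≡⟨ cong (_∸ length outside) (sym split) ⟩
    length inside + length outside ∸ length outside ≡⟨ m+n∸n≡m (length inside) (length outside) ⟩
    length inside                                   ≤⟨ inside≤S ⟩
    length S                                        ∎
    where
    open ≤-Reasoning
    inside outside : List (V n)
    inside = filter (_∈? S) (vertices n)
    outside = filter (∁? (_∈? S)) (vertices n)

    split : length inside + length outside ≡ n C 2
    split = trans (length-filter+filter-∁ (_∈? S) (vertices n)) (length-vertices n)

    inside≤S : length inside ≤ length S
    inside≤S = Unique-⊆⇒length≤ _≟ᵥ_ (Unique.filter⁺ (_∈? S) (vertices-unique n))
                                     (λ v∈inside → proj₂ (∈-filter⁻ (_∈? S) {xs = vertices n} v∈inside))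

    outside≤n/2 : length outside ≤ n / 2
    outside≤n/2 = PairwiseDisjoint⇒length≤ (Unique.filter⁺ (∁? (_∈? S)) (vertices-unique n))
      λ A∈ B∈ → outside-disjoint S-resolving (proj₂ (∈-filter⁻ (∁? (_∈? S)) {xs = vertices n} A∈))
                                             (proj₂ (∈-filter⁻ (∁? (_∈? S)) {xs = vertices n} B∈))

-- Complements of matchings are mixed resolving

IsMatching : ∀ {n} → (V n → Set) → Set
IsMatching M = ∀ {X Y x} → M X → M Y → x ∈ₚ X → x ∈ₚ Y → X ≡ Y

module _ {n : ℕ} (5≤n : 5 ≤ n) {M : V n → Set} (M? : Decidable M) (matching : IsMatching M) where

  matched-disjoint : {X Y : V n} → M X → M Y → X ≢ Y → Disjoint X Y
  matched-disjoint MX MY X≢Y x∈X x∈Y = X≢Y (matching MX MY x∈X x∈Y)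

  fresh-point : (A B : V n) → ∃ λ t → ¬ t ∈ₚ A × ¬ t ∈ₚ B
  fresh-point A B with ∃-∉ (fst A ∷ snd A ∷ fst B ∷ snd B ∷ []) 5≤n
  ... | t , t∉ = t , (λ { (at-fst p) → t∉ (here p) ; (at-snd p) → t∉ (there (here p)) })
                   , (λ { (at-fst p) → t∉ (there (there (here p)))
                        ; (at-snd p) → t∉ (there (there (there (here p)))) })

  escape : {X : V n} {q : Fin n} → M X → q ∈ₚ X → (Y : V n) →
    ∃ λ w → ¬ M w × q ∈ₚ w × (∀ {Z} → ¬ q ∈ₚ Z → (∀ {z} → z ∈ₚ Z → z ∈ₚ X ⊎ z ∈ₚ Y) → Disjoint Z w)
  escape {X} {q} MX q∈X Y with fresh-point X Y
  ... | t , t∉X , t∉Y = pair q t q≢t , ¬Mw , q∈w , avoids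
    where
    q≢t : q ≢ t
    q≢t refl = t∉X q∈X

    q∈w : q ∈ₚ pair q t q≢t
    q∈w = proj₁ (pair-∈ q t q≢t)

    ¬Mw : ¬ M (pair q t q≢t)
    ¬Mw Mw = t∉X (subst (t ∈ₚ_) (matching Mw MX q∈w q∈X) (proj₂ (pair-∈ q t q≢t)))

    avoids : ∀ {Z} → ¬ q ∈ₚ Z → (∀ {z} → z ∈ₚ Z → z ∈ₚ X ⊎ z ∈ₚ Y) → Disjoint Z (pair q t q≢t)
    avoids q∉Z Z⊆X∪Y z∈Z z∈w with ∈-pair⁻ q≢t z∈w
    ... | inj₁ refl = q∉Z z∈Z
    ... | inj₂ refl = [ t∉X , t∉Y ]′ (Z⊆X∪Y z∈Z)

  matched-path-escape : {X H Y : V n} → M X → M Y → X ≢ Y → Shared X H → Shared H Y →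
    ∃ λ w → ¬ M w × Shared X w × Disjoint H w × Disjoint Y w
  matched-path-escape {X} {H} {Y} MX MY X≢Y (p , p∈X , p∈H) (r , r∈H , r∈Y) with other-point p∈X
  ... | q , q∈X , q≢p , _ with escape MX q∈X Y
  ...   | w , ¬Mw , q∈w , avoids = w , ¬Mw , (q , q∈X , q∈w) , avoids q∉H H⊆X∪Y , avoids q∉Y inj₂
    where
    p≢r : p ≢ r
    p≢r refl = matched-disjoint MX MY X≢Y p∈X r∈Y

    q∉Y : ¬ q ∈ₚ Y
    q∉Y = matched-disjoint MX MY X≢Y q∈X

    H⊆X∪Y : ∀ {z} → z ∈ₚ H → z ∈ₚ X ⊎ z ∈ₚ Y
    H⊆X∪Y z∈H with two-points p∈H r∈H p≢r z∈H
    ... | inj₁ refl = inj₁ p∈X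
    ... | inj₂ refl = inj₂ r∈Y

    q∉H : ¬ q ∈ₚ H
    q∉H q∈H with two-points p∈H r∈H p≢r q∈H
    ... | inj₁ q≡p = q≢p q≡p
    ... | inj₂ refl = q∉Y r∈Y

  unmatched-end : (e : E n) → ∃ λ X → X ∈ₑ e × ¬ M X
  unmatched-end e with any-end? (∁? M?) e | Adj⇒Shared (proj₂ e)
  ... | inj₁ found | _ = found
  ... | inj₂ all-matched | x , x∈end₁ , x∈end₂ =
    contradiction (matching (matched (at-end₁ refl)) (matched (at-end₂ refl)) x∈end₁ x∈end₂) (end₁≢end₂ e)
    where
    matched : ∀ {X} → X ∈ₑ e → M X
    matched {X} X∈e = decidable-stable (M? X) (all-matched X∈e)

  Resolved : Item n → Item n → Set
  Resolved a b = ∃ λ w → ¬ M w × distI a w ≢ distI b w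

  resolved-sym : {a b : Item n} → Resolved a b → Resolved b a
  resolved-sym (w , ¬Mw , d≢d) = w , ¬Mw , ≢-sym d≢d

  resolve-vertices : {u v : V n} → u ≢ v → Resolved (inj₁ u) (inj₁ v)
  resolve-vertices {u} {v} u≢v with M? u | M? v
  ... | no ¬Mu | _ = u , ¬Mu , zero-vs-nonzero (dist-refl u) (λ d≡0 → u≢v (sym (dist≡0⇒≡ d≡0)))
  ... | yes _ | no ¬Mv = v , ¬Mv , ≢-sym (zero-vs-nonzero (dist-refl v) (u≢v ∘ dist≡0⇒≡))
  ... | yes Mu | yes Mv with escape Mu (at-fst refl) v
  ...   | w , ¬Mw , q∈w , avoids =
    w , ¬Mw , below-two-vs-two (dist<2 {A = u} (at-fst refl) q∈w)
                               (Disjoint⇒dist≡2 (avoids (matched-disjoint Mu Mv u≢v (at-fst refl)) inj₂))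

  resolve-vertex-off-edge : {u : V n} {e : E n} → ¬ u ∈ₑ e → Resolved (inj₁ u) (inj₂ e)
  resolve-vertex-off-edge {u} {e} u∉e with unmatched-end e
  ... | X , X∈e , ¬MX =
    X , ¬MX , ≢-sym (zero-vs-nonzero (distE-end X∈e) (λ d≡0 → u∉e (subst (_∈ₑ e) (sym (dist≡0⇒≡ d≡0)) X∈e)))

  resolve-vertex-on-edge : {u : V n} {e : E n} → u ∈ₑ e → Resolved (inj₁ u) (inj₂ e)
  resolve-vertex-on-edge {u} u∈e with other-end u∈e
  ... | H , H∈e , u≢H with distinct-ends-shared u∈e H∈e u≢H | M? H
  ...   | _ | no ¬MH = H , ¬MH , ≢-sym (zero-vs-nonzero (distE-end H∈e) (u≢H ∘ dist≡0⇒≡))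
  ...   | x , x∈u , x∈H | yes MH with other-point x∈H
  ...     | z , z∈H , z≢x , _ with escape MH z∈H u
  ...       | w , ¬Mw , z∈w , avoids =
    w , ¬Mw , ≢-sym (below-two-vs-two (distE<2 (H , H∈e , z∈H) z∈w) (Disjoint⇒dist≡2 (avoids z∉u inj₂)))
    where
    z∉u : ¬ z ∈ₚ u
    z∉u z∈u = u≢H (≡-from-two-points x∈u z∈u x∈H z∈H (λ x≡z → z≢x (sym x≡z)))

  Saturated : E n → E n → Set
  Saturated e f = ∀ {X} → X ∈ₑ e → ¬ M X → X ∈ₑ f

  saturated? : (e f : E n) → (∃ λ X → X ∈ₑ e × ¬ M X × ¬ X ∈ₑ f) ⊎ Saturated e f
  saturated? e f with any-end? (λ X → ∁? M? X ×-dec ¬? (X ∈ₑ? f)) e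
  ... | inj₁ found = inj₁ found
  ... | inj₂ none = inj₂ λ {X} X∈e ¬MX → decidable-stable (X ∈ₑ? f) (λ X∉f → none X∈e (¬MX , X∉f))

  record Overhang (e f : E n) : Set where
    field
      tip hinge : V n
      tip∈e : tip ∈ₑ e
      hinge∈e : hinge ∈ₑ e
      tip-matched : M tip
      tip∉f : ¬ tip ∈ₑ f
      hinge∈f : hinge ∈ₑ f

  overhang : {e f : E n} → ¬ e ≈E f → Saturated e f → Overhang e f
  overhang {e} {f} e≉f e-saturated with unmatched-end e
  ... | X , X∈e , ¬MX with other-end X∈e
  ...   | Y , Y∈e , X≢Y with Y ∈ₑ? f
  ...     | yes Y∈f = contradiction (≈E-from-ends X∈e Y∈e X≢Y (e-saturated X∈e ¬MX) Y∈f) e≉f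
  ...     | no Y∉f = record
    { tip = Y ; hinge = X ; tip∈e = Y∈e ; hinge∈e = X∈e
    ; tip-matched = decidable-stable (M? Y) (Y∉f ∘ e-saturated Y∈e)
    ; tip∉f = Y∉f ; hinge∈f = e-saturated X∈e ¬MX }

  resolve-overhangs : {e f : E n} → Overhang e f → Overhang f e → Resolved (inj₂ e) (inj₂ f)
  resolve-overhangs {e} {f} o o′ =
    separate (matched-path-escape (tip-matched o) (tip-matched o′) X≢Y X~H H~Y)
    where
    open Overhang

    X≢Y : tip o ≢ tip o′
    X≢Y X≡Y = tip∉f o (subst (_∈ₑ f) (sym X≡Y) (tip∈e o′))

    H≢Y : hinge o ≢ tip o′
    H≢Y H≡Y = tip∉f o′ (subst (_∈ₑ e) H≡Y (hinge∈e o))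

    X~H : Shared (tip o) (hinge o)
    X~H = distinct-ends-shared (tip∈e o) (hinge∈e o) λ X≡H → tip∉f o (subst (_∈ₑ f) (sym X≡H) (hinge∈f o))

    H~Y : Shared (hinge o) (tip o′)
    H~Y = distinct-ends-shared (hinge∈f o) (tip∈e o′) H≢Y

    separate : (∃ λ w → ¬ M w × Shared (tip o) w × Disjoint (hinge o) w × Disjoint (tip o′) w) →
      Resolved (inj₂ e) (inj₂ f)
    separate (w , ¬Mw , (q , q∈X , q∈w) , H∩w=∅ , Y∩w=∅) =
      w , ¬Mw , below-two-vs-two (distE<2 (_ , tip∈e o , q∈X) q∈w) (distE≡2 f-misses-w)
      where
      f-misses-w : ∀ {x} → x ∈ₛ f → ¬ x ∈ₚ w
      f-misses-w (_ , Z∈f , x∈Z) with distinct-ends-exhaust (hinge∈f o) (tip∈e o′) H≢Y Z∈f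
      ... | inj₁ refl = H∩w=∅ x∈Z
      ... | inj₂ refl = Y∩w=∅ x∈Z

  resolve-edges : {e f : E n} → ¬ e ≈E f → Resolved (inj₂ e) (inj₂ f)
  resolve-edges {e} {f} e≉f with saturated? e f | saturated? f e
  ... | inj₁ (X , X∈e , ¬MX , X∉f) | _ = X , ¬MX , zero-vs-nonzero (distE-end X∈e) (X∉f ∘ distE≡0⇒∈ₑ)
  ... | inj₂ _ | inj₁ (Y , Y∈f , ¬MY , Y∉e) =
    Y , ¬MY , ≢-sym (zero-vs-nonzero (distE-end Y∈f) (Y∉e ∘ distE≡0⇒∈ₑ))
  ... | inj₂ e-saturated | inj₂ f-saturated =
    resolve-overhangs (overhang e≉f e-saturated) (overhang (λ f≈e → e≉f (≈E-sym {e = f} {f = e} f≈e)) f-saturated)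

  resolve : (a b : Item n) → ¬ a ≈I b → Resolved a b
  resolve (inj₁ u) (inj₁ v) u≢v = resolve-vertices u≢v
  resolve (inj₁ u) (inj₂ e) _ with u ∈ₑ? e
  ... | yes u∈e = resolve-vertex-on-edge u∈e
  ... | no u∉e = resolve-vertex-off-edge u∉e
  resolve (inj₂ e) (inj₁ u) _ = resolved-sym {inj₁ u} {inj₂ e} (resolve (inj₁ u) (inj₂ e) λ ())
  resolve (inj₂ e) (inj₂ f) e≉f = resolve-edges {e} {f} e≉f

  matching-complement-mixedResolving : MixedResolving (filter (∁? M?) (vertices n))
  matching-complement-mixedResolving a b a≉b with resolve a b a≉b
  ... | w , ¬Mw , resolves = lose (∈-filter⁺ (∁? M?) (∈-vertices w) ¬Mw) resolves

-- The matching {{2k, 2k+1}}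

even≢1+even : ∀ {m k} → 2 ∣ m → 2 ∣ k → m ≢ suc k
even≢1+even {k = k} 2∣m 2∣k refl = contradiction (∣1⇒≡1 (∣m+n∣m⇒∣n 2∣k+1 2∣k)) λ ()
  where
  2∣k+1 : 2 ∣ k + 1
  2∣k+1 = subst (2 ∣_) (+-comm 1 k) 2∣m

module _ {n : ℕ} where

  IsBlock : V n → Set
  IsBlock v = 2 ∣ toℕ (fst v) × toℕ (snd v) ≡ suc (toℕ (fst v))

  IsBlock? : Decidable IsBlock
  IsBlock? v = (2 ∣? toℕ (fst v)) ×-dec (toℕ (snd v) ≟ℕ suc (toℕ (fst v)))

  blocks-matching : IsMatching IsBlock
  blocks-matching (_ , sX) (_ , sY) (at-fst refl) (at-fst q) =
    V-≡ q (toℕ-injective (trans sX (trans (cong (suc ∘ toℕ) q) (sym sY))))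
  blocks-matching (2∣X , _) (2∣Y , sY) (at-fst refl) (at-snd q) =
    contradiction (trans (cong toℕ q) sY) (even≢1+even 2∣X 2∣Y)
  blocks-matching (2∣X , sX) (2∣Y , _) (at-snd refl) (at-fst q) =
    contradiction (trans (cong toℕ (sym q)) sX) (even≢1+even 2∣Y 2∣X)
  blocks-matching (_ , sX) (_ , sY) (at-snd refl) (at-snd q) =
    V-≡ (toℕ-injective (suc-injective (trans (sym sX) (trans (cong toℕ q) sY)))) q

  block : Fin (n / 2) → V n
  block i = (fromℕ< 2i<n , fromℕ< 2i+1<n) ,
            subst₂ _<_ (sym (toℕ-fromℕ< 2i<n)) (sym (toℕ-fromℕ< 2i+1<n)) (n<1+n _)
    where
    2i+1<n : suc (toℕ i * 2) < n
    2i+1<n = ≤-trans (*-monoˡ-≤ 2 (toℕ<n i)) (m/n*n≤m n 2)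
    2i<n : toℕ i * 2 < n
    2i<n = <-trans (n<1+n _) 2i+1<n

  toℕ-fst-block : (i : Fin (n / 2)) → toℕ (fst (block i)) ≡ toℕ i * 2
  toℕ-fst-block i = toℕ-fromℕ< _

  block-isBlock : (i : Fin (n / 2)) → IsBlock (block i)
  block-isBlock i = subst (2 ∣_) (sym (toℕ-fst-block i)) (n∣m*n (toℕ i)) ,
                    trans (toℕ-fromℕ< _) (cong suc (sym (toℕ-fst-block i)))

  block-injective : ∀ {i j} → block i ≡ block j → i ≡ j
  block-injective {i} {j} eq = toℕ-injective (*-cancelʳ-≡ (toℕ i) (toℕ j) 2
    (trans (sym (toℕ-fst-block i)) (trans (cong (toℕ ∘ fst) eq) (toℕ-fst-block j))))

  blocks-complement-length : length (filter (∁? IsBlock?) (vertices n)) ≤ n C 2 ∸ n / 2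
  blocks-complement-length = begin
    length others                          ≡⟨ sym (m+n∸m≡n (length blocks) (length others)) ⟩
    length blocks + length others ∸ length blocks
      ≡⟨ cong (_∸ length blocks) (trans (length-filter+filter-∁ IsBlock? (vertices n)) (length-vertices n)) ⟩
    n C 2 ∸ length blocks                  ≤⟨ ∸-monoʳ-≤ (n C 2) n/2≤blocks ⟩
    n C 2 ∸ n / 2                          ∎
    where
    open ≤-Reasoning
    blocks others : List (V n)
    blocks = filter IsBlock? (vertices n)
    others = filter (∁? IsBlock?) (vertices n)

    n/2≤blocks : n / 2 ≤ length blocks
    n/2≤blocks = subst (_≤ length blocks) (trans (length-map block (allFin (n / 2))) (length-tabulate (λ i → i)))
      (Unique-⊆⇒length≤ _≟ᵥ_ (Unique.map⁺ block-injective (Unique.allFin⁺ (n / 2))) all-blocks)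
      where
      all-blocks : map block (allFin (n / 2)) ⊆ blocks
      all-blocks v∈ with ∈-map⁻ block v∈
      ... | i , _ , refl = ∈-filter⁺ IsBlock? (∈-vertices (block i)) (block-isBlock i)

isMinCard : ∀ {n} {P : List (V n) → Set} {k} (S : List (V n)) → Unique S → P S → length S ≤ k →
  ((T : List (V n)) → Unique T → P T → k ≤ length T) → IsMinCard P k
isMinCard S S! PS S≤k minimal = (S , S! , PS , ≤-antisym S≤k (minimal S S! PS)) , minimal

mixed⇒edge-resolving : ∀ {n} {S : List (V n)} → MixedResolving S → EdgeResolving S
mixed⇒edge-resolving S-mixed e f e≉f = S-mixed (inj₂ e) (inj₂ f) e≉f

theorem4 : (n : ℕ) → 5 ≤ n →
    edgeMetricDim≡ n ((n C 2) ∸ (n / 2)) × mixedMetricDim≡ n ((n C 2) ∸ (n / 2))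
theorem4 n 5≤n =
  isMinCard N N-unique (mixed⇒edge-resolving N-mixed) N-short edge-resolving⇒length≥ ,
  isMinCard N N-unique N-mixed N-short (λ S S! → edge-resolving⇒length≥ S S! ∘ mixed⇒edge-resolving)
  where
  N : List (V n)
  N = filter (∁? IsBlock?) (vertices n)

  N-unique : Unique N
  N-unique = Unique.filter⁺ (∁? IsBlock?) (vertices-unique n)

  N-mixed : MixedResolving N
  N-mixed = matching-complement-mixedResolving 5≤n IsBlock? blocks-matching

  N-short : length N ≤ n C 2 ∸ n / 2
  N-short = blocks-complement-length {n}
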